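{- Let $G$ and $H$ be graphs of orders $m\geq 2$ and $n\geq 2$, respectively. Then $$\operatorname{dem}(G\vee H)=c(G\vee H)=\min\{c(G)+n,\;c(H)+m\}.$$
   Context: Throughout, all graphs are finite, simple, undirected and connected. For a graph $G$, a set $M\subseteq V(G)$ and an edge $e\in E(G)$, $P_G(M,e)$ is the set of pairs $(x,y)$ with $x\in M$, $y\in V(G)$ such that $d_G(x,y)\neq d_{G-e}(x,y)$. An edge $e$ is monitored by a vertex $x$ if $P_G(\{x\},e)\neq\emptyset$. A set $M\subseteq V(G)$ is a distance-edge-monitoring set if every edge of $G$ is monitored by some vertex of $M$; $\operatorname{dem}(G)$ is the minimum size of a distance-edge-monitoring set. $c(G)$ denotes the vertex cover number of $G$ (minimum size of a vertex set meeting every edge). The join $G\vee H$ of disjoint graphs $G,H$ has vertex set $V(G)\cup V(H)$ and edge set $E(G)\cup E(H)\cup\{uv: u\in V(G), v\in V(H)\}$. -}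

module Defs where

open import Level using (0ℓ)
open import Data.Nat using (ℕ; zero; suc; _+_; _<_; _≤_; _⊔_; _⊓_)
open import Data.Fin using (Fin; splitAt)
open import Data.Fin.Subset using (Subset; _∈_; ∣_∣)
open import Data.Sum using (_⊎_; inj₁; inj₂)
open import Data.Product using (Σ; _×_; _,_; ∃; ∃-syntax)
open import Data.Empty using (⊥)
open import Data.Unit using (⊤)
open import Relation.Nullary using (¬_)
open import Relation.Binary.PropositionalEquality using (_≡_)
open import Function.Bundles using (_⇔_)

record Graph (n : ℕ) : Set₁ where
  field
    Adj   : Fin n → Fin n → Set
    sym   : ∀ {x y} → Adj x y → Adj y x
    irrefl : ∀ {x} → ¬ Adj x x
open Graph public

data Walk {n : ℕ} (G : Graph n) : ℕ → Fin n → Fin n → Set where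
  here : ∀ {x} → Walk G zero x x
  step : ∀ {k x y z} → Adj G x y → Walk G k y z → Walk G (suc k) x z

Connected : ∀ {n} → Graph n → Set
Connected G = ∀ x y → ∃[ k ] Walk G k x y

-- d_G(x,y) = k  (relational; no such k when y is unreachable, i.e. distance ∞)
Dist : ∀ {n} → Graph n → Fin n → Fin n → ℕ → Set
Dist G x y k = Walk G k x y × (∀ j → j < k → ¬ Walk G j x y)

deleteEdge : ∀ {n} (G : Graph n) (u v : Fin n) → Graph n
deleteEdge G u v = record
  { Adj = λ a b → Adj G a b × ¬ ((a ≡ u × b ≡ v) ⊎ (a ≡ v × b ≡ u))
  ; sym = λ { (p , q) → sym G p , λ { (inj₁ (r , s)) → q (inj₂ (s , r))
                                    ; (inj₂ (r , s)) → q (inj₁ (s , r)) } }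
  ; irrefl = λ { (p , _) → irrefl G p }
  }

-- d_G(x,y) = d_{G'}(x,y) (including the case where both are ∞)
SameDist : ∀ {n} → Graph n → Graph n → Fin n → Fin n → Set
SameDist G G' x y = ∀ k → Dist G x y k ⇔ Dist G' x y k

Monitors : ∀ {n} (G : Graph n) → Fin n → (u v : Fin n) → Set
Monitors G x u v = ∃[ y ] ¬ SameDist G (deleteEdge G u v) x y

IsDEMSet : ∀ {n} → Graph n → Subset n → Set
IsDEMSet G M = ∀ u v → Adj G u v → ∃[ x ] (x ∈ M × Monitors G x u v)

IsVertexCover : ∀ {n} → Graph n → Subset n → Set
IsVertexCover G C = ∀ u v → Adj G u v → (u ∈ C ⊎ v ∈ C)

IsMinSize : ∀ {n} → (Subset n → Set) → ℕ → Set
IsMinSize P k = (∃[ M ] (P M × ∣ M ∣ ≡ k)) × (∀ M → P M → k ≤ ∣ M ∣)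

IsDem : ∀ {n} → Graph n → ℕ → Set
IsDem G = IsMinSize (IsDEMSet G)

IsVCNumber : ∀ {n} → Graph n → ℕ → Set
IsVCNumber G = IsMinSize (IsVertexCover G)

-- Join G ∨ H on Fin (m + n): first m vertices from G, last n from H.
joinAdj : ∀ {m n} → Graph m → Graph n → Fin m ⊎ Fin n → Fin m ⊎ Fin n → Set
joinAdj G H (inj₁ a) (inj₁ b) = Adj G a b
joinAdj G H (inj₂ a) (inj₂ b) = Adj H a b
joinAdj G H (inj₁ _) (inj₂ _) = ⊤
joinAdj G H (inj₂ _) (inj₁ _) = ⊤

joinAdj-sym : ∀ {m n} (G : Graph m) (H : Graph n) a b → joinAdj G H a b → joinAdj G H b a
joinAdj-sym G H (inj₁ a) (inj₁ b) p = sym G p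
joinAdj-sym G H (inj₂ a) (inj₂ b) p = sym H p
joinAdj-sym G H (inj₁ _) (inj₂ _) p = _
joinAdj-sym G H (inj₂ _) (inj₁ _) p = _

joinAdj-irrefl : ∀ {m n} (G : Graph m) (H : Graph n) a → ¬ joinAdj G H a a
joinAdj-irrefl G H (inj₁ a) = irrefl G
joinAdj-irrefl G H (inj₂ a) = irrefl H

_∨ᴳ_ : ∀ {m n} → Graph m → Graph n → Graph (m + n)
_∨ᴳ_ {m} G H = record
  { Adj = λ x y → joinAdj G H (splitAt m x) (splitAt m y)
  ; sym = λ {x} {y} → joinAdj-sym G H (splitAt m x) (splitAt m y)
  ; irrefl = λ {x} → joinAdj-irrefl G H (splitAt m x)
  }

-- Endpoints always monitor their edge, so every vertex cover is a
-- distance-edge-monitoring set. Conversely, in G ∨ H with m, n ≥ 2 every vertex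
-- x is adjacent to each other vertex y or shares two distinct neighbours with
-- it; so deleting an edge not incident to x leaves a path of the same length
-- from x to y, and x monitors no such edge. Hence the two notions coincide on
-- G ∨ H and dem = c there. A vertex cover of G ∨ H restricts to covers of G and
-- of H, and must contain a whole side to cover the edges between the sides,
-- which gives c(G ∨ H) = min (c(G) + n) (c(H) + m).
{-# OPTIONS --safe #-}
module Submission where

open import Defs
open import Data.Nat using (ℕ; zero; suc; _+_; _≤_; _⊓_; z≤n; s≤s)
open import Data.Nat.Properties
  using (≤-antisym; ≮⇒≥; ≤-<-trans; +-comm; ⊓-sel; m⊓n≤m; m⊓n≤n; +-mono-≤; module ≤-Reasoning)
open import Data.Fin using (Fin; _↑ˡ_; _↑ʳ_) renaming (zero to fzero; suc to fsuc)
open import Data.Fin.Properties using (_≟_; splitAt-↑ˡ; splitAt-↑ʳ; ↑ˡ-injective; ↑ʳ-injective; 0≢1+n; all?; ¬∀⟶∃¬)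
open import Data.Fin.Subset using (Subset; _∈_; _∉_; ∣_∣; ⊤; inside; outside)
open import Data.Fin.Subset.Properties using (_∈?_; ∈⊤; ∣⊤∣≡n; p⊆q⇒∣p∣≤∣q∣)
open import Data.Vec using ([]; _∷_; _++_; lookup)
import Data.Vec as Vec
open import Data.Vec.Properties using ([]=⇒lookup; lookup⇒[]=; lookup-++ˡ; lookup-++ʳ)
open import Data.Sum using (_⊎_; inj₁; inj₂)
open import Data.Product using (_×_; _,_; proj₁; proj₂; ∃-syntax; ∃₂)
open import Data.Empty using (⊥-elim)
open import Data.Unit using (tt)
open import Function using (_⇔_; mk⇔)
open import Function.Bundles using (module Equivalence)
open import Relation.Nullary using (¬_; Dec; yes; no)
open import Relation.Nullary.Decidable using (_⊎-dec_; _×-dec_)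
open import Relation.Binary.PropositionalEquality
  using (_≡_; _≢_; refl; trans; cong; cong₂; subst; module ≡-Reasoning)
  renaming (sym to ≡-sym)

open Equivalence using (to; from)

IsMinSize-⇔ : ∀ {N} {P Q : Subset N → Set} {k} →
              (∀ M → P M ⇔ Q M) → IsMinSize P k → IsMinSize Q k
IsMinSize-⇔ P⇔Q ((M , PM , ∣M∣≡k) , min) =
  (M , to (P⇔Q M) PM , ∣M∣≡k) , λ M′ QM′ → min M′ (from (P⇔Q M′) QM′)

SamePair : ∀ {N} → Fin N → Fin N → Fin N → Fin N → Set
SamePair u v a b = (a ≡ u × b ≡ v) ⊎ (a ≡ v × b ≡ u)

samePair? : ∀ {N} (u v a b : Fin N) → Dec (SamePair u v a b)
samePair? u v a b = ((a ≟ u) ×-dec (b ≟ v)) ⊎-dec ((a ≟ v) ×-dec (b ≟ u))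

samePair-partner-unique : ∀ {N} {u v w w′ y : Fin N} → u ≢ v →
                          SamePair u v w y → SamePair u v w′ y → w ≡ w′
samePair-partner-unique u≢v (inj₁ (refl , refl)) (inj₁ (refl , _))    = refl
samePair-partner-unique u≢v (inj₁ (_ , refl))    (inj₂ (_ , v≡u))     = ⊥-elim (u≢v (≡-sym v≡u))
samePair-partner-unique u≢v (inj₂ (_ , refl))    (inj₁ (_ , u≡v))     = ⊥-elim (u≢v u≡v)
samePair-partner-unique u≢v (inj₂ (refl , refl)) (inj₂ (refl , _))    = refl

dist-adjacent : ∀ {N} (K : Graph N) {x y} → Adj K x y → Dist K x y 1
dist-adjacent K xy = step xy here , λ { zero _ here → irrefl K xy ; (suc _) (s≤s ()) _ }

sameDist-if-shortenable : ∀ {N} {K K′ : Graph N} →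
  (∀ {k x y} → Walk K′ k x y → Walk K k x y) →
  ∀ {x y} → (∀ {k} → Walk K k x y → ∃[ j ] (j ≤ k × Walk K′ j x y)) →
  SameDist K K′ x y
sameDist-if-shortenable {K = K} {K′} lift {x} {y} shorten k = mk⇔ dist⁺ dist⁻
  where
  dist⁺ : Dist K x y k → Dist K′ x y k
  dist⁺ (w , shortest) with shorten w
  ... | j , j≤k , w′ =
    subst (λ i → Walk K′ i x y) (≤-antisym j≤k (≮⇒≥ λ j<k → shortest j j<k (lift w′))) w′ ,
    λ i i<k w″ → shortest i i<k (lift w″)
  dist⁻ : Dist K′ x y k → Dist K x y k
  dist⁻ (w′ , shortest′) = lift w′ , λ i i<k w →
    let (j , j≤i , w″) = shorten w in shortest′ j (≤-<-trans j≤i i<k) w″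

module _ {N : ℕ} (K : Graph N) where

  TwoCommonNeighbours : Fin N → Fin N → Set
  TwoCommonNeighbours x y =
    ∃₂ λ w w′ → w ≢ w′ × (Adj K x w × Adj K w y) × (Adj K x w′ × Adj K w′ y)

  AdjacentOrTwoCommonNeighbours : Fin N → Set
  AdjacentOrTwoCommonNeighbours x = ∀ y → y ≢ x → Adj K x y ⊎ TwoCommonNeighbours x y

  deleteEdge-walk : ∀ {u v k x y} → Walk (deleteEdge K u v) k x y → Walk K k x y
  deleteEdge-walk here             = here
  deleteEdge-walk (step (xz , _) w) = step xz (deleteEdge-walk w)

  module _ {u v : Fin N} (uv : Adj K u v) where

    private
      K′ : Graph N
      K′ = deleteEdge K u v

      u≢v : u ≢ v
      u≢v refl = irrefl K uv

    ¬sameDist-endpoints : ∀ {x y} → Adj K x y → SamePair u v x y → ¬ SameDist K K′ x y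
    ¬sameDist-endpoints xy xy≐uv same with to (same 1) (dist-adjacent K xy)
    ... | step (_ , ¬xy≐uv) here , _ = ¬xy≐uv xy≐uv

    endpoint-monitors : Monitors K u u v × Monitors K v u v
    endpoint-monitors = (v , ¬sameDist-endpoints uv (inj₁ (refl , refl)))
                      , (u , ¬sameDist-endpoints (sym K uv) (inj₂ (refl , refl)))

    module _ {x : Fin N} (x≢u : x ≢ u) (x≢v : x ≢ v) where

      private
        edges-from-x-kept : ∀ {y} → ¬ SamePair u v x y
        edges-from-x-kept (inj₁ (x≡u , _)) = x≢u x≡u
        edges-from-x-kept (inj₂ (x≡v , _)) = x≢v x≡v

      -- Since w ≢ w′, at most one of the edges wy, w′y is the deleted one.
      twoCommonNeighbours-walk : ∀ {y} → TwoCommonNeighbours x y → Walk K′ 2 x y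
      twoCommonNeighbours-walk {y} (w , w′ , w≢w′ , (xw , wy) , (xw′ , w′y))
        with samePair? u v w y
      ... | no ¬wy≐uv = step (xw , edges-from-x-kept) (step (wy , ¬wy≐uv) here)
      ... | yes wy≐uv = step (xw′ , edges-from-x-kept)
                          (step (w′y , λ w′y≐uv →
                                  w≢w′ (samePair-partner-unique u≢v wy≐uv w′y≐uv)) here)

      shorten-avoiding : AdjacentOrTwoCommonNeighbours x →
                         ∀ {k y} → Walk K k x y → ∃[ j ] (j ≤ k × Walk K′ j x y)
      shorten-avoiding _     here                = 0 , z≤n , here
      shorten-avoiding _     (step xy here)      = 1 , s≤s z≤n , step (xy , edges-from-x-kept) here
      shorten-avoiding close {y = y} (step _ (step _ _)) with y ≟ x
      ... | yes refl = 0 , z≤n , here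
      ... | no y≢x with close y y≢x
      ...   | inj₁ xy     = 1 , s≤s z≤n , step (xy , edges-from-x-kept) here
      ...   | inj₂ common = 2 , s≤s (s≤s z≤n) , twoCommonNeighbours-walk common

      nonEndpoint-sameDist : AdjacentOrTwoCommonNeighbours x → ∀ y → SameDist K K′ x y
      nonEndpoint-sameDist close y =
        sameDist-if-shortenable deleteEdge-walk (shorten-avoiding close)

    monitors⇒endpoint : (∀ x → AdjacentOrTwoCommonNeighbours x) →
                        ∀ x → Monitors K x u v → x ≡ u ⊎ x ≡ v
    monitors⇒endpoint close x (y , ¬same) with x ≟ u | x ≟ v
    ... | yes x≡u | _       = inj₁ x≡u
    ... | no _    | yes x≡v = inj₂ x≡v
    ... | no x≢u  | no x≢v  = ⊥-elim (¬same (nonEndpoint-sameDist x≢u x≢v (close x) y))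

  vertexCover⇒DEMSet : ∀ M → IsVertexCover K M → IsDEMSet K M
  vertexCover⇒DEMSet M cover u v uv with cover u v uv
  ... | inj₁ u∈M = u , u∈M , proj₁ (endpoint-monitors uv)
  ... | inj₂ v∈M = v , v∈M , proj₂ (endpoint-monitors uv)

  DEMSet⇒vertexCover : (∀ x → AdjacentOrTwoCommonNeighbours x) →
                       ∀ M → IsDEMSet K M → IsVertexCover K M
  DEMSet⇒vertexCover close M dem u v uv with dem u v uv
  ... | x , x∈M , monitors with monitors⇒endpoint uv close x monitors
  ...   | inj₁ refl = inj₁ x∈M
  ...   | inj₂ refl = inj₂ x∈M

  ⊤-vertexCover : IsVertexCover K ⊤
  ⊤-vertexCover _ _ _ = inj₁ ∈⊤

  IsVCNumber⇒IsDem : (∀ x → AdjacentOrTwoCommonNeighbours x) → ∀ {k} → IsVCNumber K k → IsDem K k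
  IsVCNumber⇒IsDem close =
    IsMinSize-⇔ λ M → mk⇔ (vertexCover⇒DEMSet M) (DEMSet⇒vertexCover close M)

data Side (m n : ℕ) : Fin (m + n) → Set where
  left  : (a : Fin m) → Side m n (a ↑ˡ n)
  right : (b : Fin n) → Side m n (m ↑ʳ b)

side : ∀ m n (x : Fin (m + n)) → Side m n x
side zero    n x        = right x
side (suc m) n fzero    = left fzero
side (suc m) n (fsuc x) with side m n x
... | left a  = left (fsuc a)
... | right b = right b

Full : ∀ {k} → Subset k → Set
Full {k} p = (a : Fin k) → a ∈ p

Full-⊤ : ∀ {k} → Full (⊤ {k})
Full-⊤ _ = ∈⊤

Full⇒n≤∣p∣ : ∀ {k} {p : Subset k} → Full p → k ≤ ∣ p ∣
Full⇒n≤∣p∣ {k} {p} full = subst (_≤ ∣ p ∣) (∣⊤∣≡n k) (p⊆q⇒∣p∣≤∣q∣ {p = ⊤} λ {a} _ → full a)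

∣++∣ : ∀ {k l} (p : Subset k) (q : Subset l) → ∣ p ++ q ∣ ≡ ∣ p ∣ + ∣ q ∣
∣++∣ []            q = refl
∣++∣ (inside ∷ p)  q = cong suc (∣++∣ p q)
∣++∣ (outside ∷ p) q = ∣++∣ p q

∈-lookup-cong : ∀ {k l} {p : Subset k} {q : Subset l} {a b} →
                lookup p a ≡ lookup q b → a ∈ p → b ∈ q
∈-lookup-cong {q = q} {b = b} eq a∈p = lookup⇒[]= b q (trans (≡-sym eq) ([]=⇒lookup a∈p))

module _ {m n : ℕ} {p : Subset m} {q : Subset n} where

  ↑ˡ∈++⇔ : ∀ a → a ↑ˡ n ∈ p ++ q ⇔ a ∈ p
  ↑ˡ∈++⇔ a = mk⇔ (∈-lookup-cong (lookup-++ˡ p q a)) (∈-lookup-cong (≡-sym (lookup-++ˡ p q a)))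

  ↑ʳ∈++⇔ : ∀ b → m ↑ʳ b ∈ p ++ q ⇔ b ∈ q
  ↑ʳ∈++⇔ b = mk⇔ (∈-lookup-cong (lookup-++ʳ p q b)) (∈-lookup-cong (≡-sym (lookup-++ʳ p q b)))

module _ {m n : ℕ} (G : Graph m) (H : Graph n) where

  ∨ᴳ-adj-↑ˡ : ∀ a a′ → Adj (G ∨ᴳ H) (a ↑ˡ n) (a′ ↑ˡ n) ⇔ Adj G a a′
  ∨ᴳ-adj-↑ˡ a a′ rewrite splitAt-↑ˡ m a n | splitAt-↑ˡ m a′ n = mk⇔ (λ e → e) (λ e → e)

  ∨ᴳ-adj-↑ʳ : ∀ b b′ → Adj (G ∨ᴳ H) (m ↑ʳ b) (m ↑ʳ b′) ⇔ Adj H b b′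
  ∨ᴳ-adj-↑ʳ b b′ rewrite splitAt-↑ʳ m n b | splitAt-↑ʳ m n b′ = mk⇔ (λ e → e) (λ e → e)

  ∨ᴳ-adj-↑ˡ↑ʳ : ∀ a b → Adj (G ∨ᴳ H) (a ↑ˡ n) (m ↑ʳ b)
  ∨ᴳ-adj-↑ˡ↑ʳ a b rewrite splitAt-↑ˡ m a n | splitAt-↑ʳ m n b = tt

  ∨ᴳ-adj-↑ʳ↑ˡ : ∀ b a → Adj (G ∨ᴳ H) (m ↑ʳ b) (a ↑ˡ n)
  ∨ᴳ-adj-↑ʳ↑ˡ b a rewrite splitAt-↑ˡ m a n | splitAt-↑ʳ m n b = tt

  -- Two vertices on the same side have the first two vertices of the other
  -- side as common neighbours.
  ∨ᴳ-adjacentOrTwoCommonNeighbours : 2 ≤ m → 2 ≤ n →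
                                     ∀ x → AdjacentOrTwoCommonNeighbours (G ∨ᴳ H) x
  ∨ᴳ-adjacentOrTwoCommonNeighbours (s≤s (s≤s _)) (s≤s (s≤s _)) x y _
    with side m n x | side m n y
  ... | left a  | left a′ =
    inj₂ (m ↑ʳ fzero , m ↑ʳ fsuc fzero ,
          (λ eq → 0≢1+n (↑ʳ-injective {m = n} m fzero (fsuc fzero) eq)) ,
          (∨ᴳ-adj-↑ˡ↑ʳ a fzero , ∨ᴳ-adj-↑ʳ↑ˡ fzero a′) ,
          (∨ᴳ-adj-↑ˡ↑ʳ a (fsuc fzero) , ∨ᴳ-adj-↑ʳ↑ˡ (fsuc fzero) a′))
  ... | left a  | right b = inj₁ (∨ᴳ-adj-↑ˡ↑ʳ a b)
  ... | right b | left a  = inj₁ (∨ᴳ-adj-↑ʳ↑ˡ b a)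
  ... | right b | right b′ =
    inj₂ (_↑ˡ_ {m} fzero n , _↑ˡ_ {m} (fsuc fzero) n ,
          (λ eq → 0≢1+n (↑ˡ-injective {m = m} n fzero (fsuc fzero) eq)) ,
          (∨ᴳ-adj-↑ʳ↑ˡ b fzero , ∨ᴳ-adj-↑ˡ↑ʳ fzero b′) ,
          (∨ᴳ-adj-↑ʳ↑ˡ b (fsuc fzero) , ∨ᴳ-adj-↑ˡ↑ʳ (fsuc fzero) b′))

  ∨ᴳ-vertexCover⁺ : ∀ {p : Subset m} {q : Subset n} →
                    IsVertexCover G p → IsVertexCover H q → Full p ⊎ Full q →
                    IsVertexCover (G ∨ᴳ H) (p ++ q)
  ∨ᴳ-vertexCover⁺ coverG coverH full x y xy with side m n x | side m n y
  ... | left a  | left a′ with coverG a a′ (to (∨ᴳ-adj-↑ˡ a a′) xy)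
  ...   | inj₁ a∈p  = inj₁ (from (↑ˡ∈++⇔ a) a∈p)
  ...   | inj₂ a′∈p = inj₂ (from (↑ˡ∈++⇔ a′) a′∈p)
  ∨ᴳ-vertexCover⁺ coverG coverH full x y xy | right b | right b′
    with coverH b b′ (to (∨ᴳ-adj-↑ʳ b b′) xy)
  ...   | inj₁ b∈q  = inj₁ (from (↑ʳ∈++⇔ b) b∈q)
  ...   | inj₂ b′∈q = inj₂ (from (↑ʳ∈++⇔ b′) b′∈q)
  ∨ᴳ-vertexCover⁺ coverG coverH (inj₁ fullp) x y xy | left a | right b = inj₁ (from (↑ˡ∈++⇔ a) (fullp a))
  ∨ᴳ-vertexCover⁺ coverG coverH (inj₂ fullq) x y xy | left a | right b = inj₂ (from (↑ʳ∈++⇔ b) (fullq b))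
  ∨ᴳ-vertexCover⁺ coverG coverH (inj₁ fullp) x y xy | right b | left a = inj₂ (from (↑ˡ∈++⇔ a) (fullp a))
  ∨ᴳ-vertexCover⁺ coverG coverH (inj₂ fullq) x y xy | right b | left a = inj₁ (from (↑ʳ∈++⇔ b) (fullq b))

  ∨ᴳ-vertexCover⁻ : ∀ (p : Subset m) (q : Subset n) → IsVertexCover (G ∨ᴳ H) (p ++ q) →
                    IsVertexCover G p × IsVertexCover H q × (Full p ⊎ Full q)
  ∨ᴳ-vertexCover⁻ p q cover = coverG , coverH , full
    where
    coverG : IsVertexCover G p
    coverG a a′ aa′ with cover (a ↑ˡ n) (a′ ↑ˡ n) (from (∨ᴳ-adj-↑ˡ a a′) aa′)
    ... | inj₁ a∈ = inj₁ (to (↑ˡ∈++⇔ a) a∈)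
    ... | inj₂ a′∈ = inj₂ (to (↑ˡ∈++⇔ a′) a′∈)
    coverH : IsVertexCover H q
    coverH b b′ bb′ with cover (m ↑ʳ b) (m ↑ʳ b′) (from (∨ᴳ-adj-↑ʳ b b′) bb′)
    ... | inj₁ b∈ = inj₁ (to (↑ʳ∈++⇔ b) b∈)
    ... | inj₂ b′∈ = inj₂ (to (↑ʳ∈++⇔ b′) b′∈)
    Full-if-∉ : ∀ {b} → b ∉ q → Full p
    Full-if-∉ b∉q a with cover (a ↑ˡ n) (m ↑ʳ _) (∨ᴳ-adj-↑ˡ↑ʳ a _)
    ... | inj₁ a∈ = to (↑ˡ∈++⇔ a) a∈
    ... | inj₂ b∈ = ⊥-elim (b∉q (to (↑ʳ∈++⇔ _) b∈))
    full : Full p ⊎ Full q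
    full with all? (_∈? q)
    ... | yes fullq = inj₂ fullq
    ... | no ¬fullq with ¬∀⟶∃¬ n (_∈ q) (_∈? q) ¬fullq
    ...   | _ , b∉q = inj₁ (Full-if-∉ b∉q)

  ∨ᴳ-vertexCoverNumber : ∀ {cG cH} → IsVCNumber G cG → IsVCNumber H cH →
                         IsVCNumber (G ∨ᴳ H) ((cG + n) ⊓ (cH + m))
  ∨ᴳ-vertexCoverNumber {cG} {cH} ((CG , coverG , ∣CG∣) , minG) ((CH , coverH , ∣CH∣) , minH) =
    optimal , lowerBound
    where
    optimal : ∃[ M ] (IsVertexCover (G ∨ᴳ H) M × ∣ M ∣ ≡ (cG + n) ⊓ (cH + m))
    optimal with ⊓-sel (cG + n) (cH + m)
    ... | inj₁ min≡G =
      CG ++ ⊤ , ∨ᴳ-vertexCover⁺ coverG (⊤-vertexCover H) (inj₂ Full-⊤) , (begin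
        ∣ CG ++ ⊤ {n} ∣         ≡⟨ ∣++∣ CG (⊤ {n}) ⟩
        ∣ CG ∣ + ∣ ⊤ {n} ∣       ≡⟨ cong₂ _+_ ∣CG∣ (∣⊤∣≡n n) ⟩
        cG + n                  ≡⟨ min≡G ⟨
        (cG + n) ⊓ (cH + m)     ∎)
      where open ≡-Reasoning
    ... | inj₂ min≡H =
      ⊤ ++ CH , ∨ᴳ-vertexCover⁺ (⊤-vertexCover G) coverH (inj₁ Full-⊤) , (begin
        ∣ ⊤ {m} ++ CH ∣         ≡⟨ ∣++∣ (⊤ {m}) CH ⟩
        ∣ ⊤ {m} ∣ + ∣ CH ∣       ≡⟨ cong₂ _+_ (∣⊤∣≡n m) ∣CH∣ ⟩
        m + cH                  ≡⟨ +-comm m cH ⟩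
        cH + m                  ≡⟨ min≡H ⟨
        (cG + n) ⊓ (cH + m)     ∎)
      where open ≡-Reasoning
    lowerBound : ∀ M → IsVertexCover (G ∨ᴳ H) M → (cG + n) ⊓ (cH + m) ≤ ∣ M ∣
    lowerBound M cover with Vec.splitAt m M
    ... | p , q , refl with ∨ᴳ-vertexCover⁻ p q cover
    ...   | coverG , _ , inj₂ fullq = begin
      (cG + n) ⊓ (cH + m) ≤⟨ m⊓n≤m _ _ ⟩
      cG + n              ≤⟨ +-mono-≤ (minG p coverG) (Full⇒n≤∣p∣ fullq) ⟩
      ∣ p ∣ + ∣ q ∣        ≡⟨ ∣++∣ p q ⟨
      ∣ p ++ q ∣          ∎
      where open ≤-Reasoning
    ...   | _ , coverH , inj₁ fullp = begin
      (cG + n) ⊓ (cH + m) ≤⟨ m⊓n≤n _ _ ⟩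
      cH + m              ≡⟨ +-comm cH m ⟩
      m + cH              ≤⟨ +-mono-≤ (Full⇒n≤∣p∣ fullp) (minH q coverH) ⟩
      ∣ p ∣ + ∣ q ∣        ≡⟨ ∣++∣ p q ⟨
      ∣ p ++ q ∣          ∎
      where open ≤-Reasoning

mainTheorem1 : (m n : ℕ) (G : Graph m) (H : Graph n)
    → 2 ≤ m → 2 ≤ n → Connected G → Connected H
    → (cG cH : ℕ) → IsVCNumber G cG → IsVCNumber H cH
    → IsDem (G ∨ᴳ H) ((cG + n) ⊓ (cH + m)) × IsVCNumber (G ∨ᴳ H) ((cG + n) ⊓ (cH + m))
mainTheorem1 m n G H 2≤m 2≤n _ _ cG cH cG-min cH-min =
  IsVCNumber⇒IsDem (G ∨ᴳ H) (∨ᴳ-adjacentOrTwoCommonNeighbours G H 2≤m 2≤n) c , c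
  where
  c : IsVCNumber (G ∨ᴳ H) ((cG + n) ⊓ (cH + m))
  c = ∨ᴳ-vertexCoverNumber G H cG-min cH-min
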